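{- The left dual ${}^{\star}\mathscr M$ of a Moore machine $\mathscr M$ is equal to its bidual; consequently the machine $\mathscr M^\natural={}^{\star}(\mathscr M_{\star})$ (the left dual of the right dual of $\mathscr M$) is equal to its bidual.
   Context: A Moore machine is $\mathscr M=(Q,\Sigma,\Delta,\delta,\lambda,\mathsf i)$ with finite state set $Q$, finite alphabets $\Sigma,\Delta$, transition $\delta:Q\times\Sigma\to Q$, output $\lambda:Q\to\Delta$, initial state $\mathsf i$, and all states of the form $\mathsf i\cdot w$. Right action of words on states: $a\cdot\epsilon=a$, $a\cdot j=\delta(a,j)$, $a\cdot wj=(a\cdot w)\cdot j$; left action: $\epsilon\cdot a=a$, $j\cdot a=\delta(a,j)$, $jw\cdot a=j\cdot(w\cdot a)$. For $f$ a function on $Q$: $(w\cdot f)(a)=f(a\cdot w)$, $(f\cdot w)(a)=f(w\cdot a)$. The right dual is $\mathscr M_\star=(Q_\star,\Sigma,\Delta,\delta_\star,\lambda_\star,\mathsf i_\star)$ with $Q_\star=\{w\cdot\lambda: w\in\Sigma^*\}\subset\Delta^Q$, $\delta_\star(f,j)=j\cdot f$, $\lambda_\star(f)=f(\mathsf i)$, $\mathsf i_\star=\lambda$. The left dual is ${}^{\star}\mathscr M=({}^{\star}Q,\Sigma,\Delta,{}^{\star}\delta,{}^{\star}\lambda,{}^{\star}\mathsf i)$ with ${}^{\star}Q=\{\lambda\cdot w: w\in\Sigma^*\}\subset\Delta^Q$, ${}^{\star}\delta(f,j)=f\cdot j$, ${}^{\star}\lambda(f)=f(\mathsf i)$, ${}^{\star}\mathsf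 i=\lambda$. The bidual of a machine is obtained by taking the right dual and then the left dual of it; "equal to its bidual" means the natural evaluation map $\tau$ from states to functions on dual states, $\tau_a(f)=f(a)$, is a bijection onto the bidual's states (an isomorphism). -}

module Defs where

open import Data.Nat using (ℕ)
open import Data.Fin using (Fin)
open import Data.List using (List; []; _∷_; _++_; [_])
open import Data.Product using (Σ; Σ-syntax; ∃; ∃-syntax; _×_; _,_; proj₁)
open import Relation.Binary.PropositionalEquality
  using (_≡_; refl; sym; trans; cong; isEquivalence)
open import Relation.Binary.Structures using (IsEquivalence)

-- Moore machines whose state set carries an equality (a setoid).
-- This generality is needed because the states of a dual machine are
-- *functions* on the states of the original machine, compared
-- pointwise (there is no function extensionality in --safe Agda).
-- Reachability/finiteness are not fields here; they are imposed on the
-- paper's (plain) machines below, and dual machines are reachable by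
-- construction (their states are by definition of the form w·λ / λ·w).

record Moore (A B : Set) : Set₁ where
  field
    State    : Set
    _≈_      : State → State → Set
    ≈-equiv  : IsEquivalence _≈_
    δ        : State → A → State
    out      : State → B
    init     : State
    δ-cong   : ∀ {a b} j → a ≈ b → δ a j ≈ δ b j
    out-cong : ∀ {a b} → a ≈ b → out a ≡ out b

module _ {A B : Set} (M : Moore A B) where
  open Moore M

  _·ʳ_ : State → List A → State
  a ·ʳ []      = a
  a ·ʳ (j ∷ w) = δ a j ·ʳ w

  _·ˡ_ : List A → State → State
  []      ·ˡ a = a
  (j ∷ w) ·ˡ a = δ (w ·ˡ a) j

  ·ˡ-snoc : ∀ w j a → (w ++ [ j ]) ·ˡ a ≡ w ·ˡ δ a j
  ·ˡ-snoc []      j a = refl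
  ·ˡ-snoc (x ∷ w) j a = cong (λ s → δ s x) (·ˡ-snoc w j a)

  InRightDualSet : (State → B) → Set
  InRightDualSet f = ∃[ w ] (∀ a → f a ≡ out (a ·ʳ w))

  InLeftDualSet : (State → B) → Set
  InLeftDualSet f = ∃[ w ] (∀ a → f a ≡ out (w ·ˡ a))

_≐_ : {S B : Set} → (S → B) → (S → B) → Set
f ≐ g = ∀ a → f a ≡ g a

≐-equiv : {S B : Set} {P : (S → B) → Set} →
          IsEquivalence {A = Σ (S → B) P} (λ f g → proj₁ f ≐ proj₁ g)
≐-equiv = record
  { refl  = λ a → refl
  ; sym   = λ p a → sym (p a)
  ; trans = λ p q a → trans (p a) (q a)
  }

RightDual : {A B : Set} → Moore A B → Moore A B
RightDual {A} {B} M = record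
  { State    = Σ (State → B) (InRightDualSet M)
  ; _≈_      = λ f g → proj₁ f ≐ proj₁ g
  ; ≈-equiv  = ≐-equiv
  ; δ        = λ { (f , w , p) j → (λ a → f (δ a j)) , j ∷ w , (λ a → p (δ a j)) }
  ; out      = λ f → proj₁ f init
  ; init     = out , [] , (λ a → refl)
  ; δ-cong   = λ j e a → e (δ a j)
  ; out-cong = λ e → e init
  }
  where open Moore M

LeftDual : {A B : Set} → Moore A B → Moore A B
LeftDual {A} {B} M = record
  { State    = Σ (State → B) (InLeftDualSet M)
  ; _≈_      = λ f g → proj₁ f ≐ proj₁ g
  ; ≈-equiv  = ≐-equiv
  ; δ        = λ { (f , w , p) j →
                   (λ a → f (δ a j)) , w ++ [ j ] ,
                   (λ a → trans (p (δ a j)) (cong out (sym (·ˡ-snoc M w j a)))) }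
  ; out      = λ f → proj₁ f init
  ; init     = out , [] , (λ a → refl)
  ; δ-cong   = λ j e a → e (δ a j)
  ; out-cong = λ e → e init
  }
  where open Moore M

Bidual : {A B : Set} → Moore A B → Moore A B
Bidual M = LeftDual (RightDual M)

IsIso : {A B : Set} (M N : Moore A B) → (Moore.State M → Moore.State N) → Set
IsIso M N h =
    (∀ a b → a ≈ b → h a ≈' h b)
  × (∀ a b → h a ≈' h b → a ≈ b)
  × (∀ c → ∃[ a ] (h a ≈' c))
  × (∀ a j → h (δ a j) ≈' δ' (h a) j)
  × (∀ a → out a ≡ out' (h a))
  × (h init ≈' init')
  where
    open Moore M
    open Moore N renaming (_≈_ to _≈'_; δ to δ'; out to out'; init to init')

ev : {A B : Set} (M : Moore A B) → Moore.State M → Moore.State (RightDual M) → B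
ev M a f = proj₁ f a

EqualToBidual : {A B : Set} → Moore A B → Set
EqualToBidual M =
  Σ (∀ a → InLeftDualSet (RightDual M) (ev M a))
    (λ mem → IsIso M (Bidual M) (λ a → ev M a , mem a))

act : ∀ {n k} → (Fin n → Fin k → Fin n) → Fin n → List (Fin k) → Fin n
act δ a []      = a
act δ a (j ∷ w) = act δ (δ a j) w

record MooreMachine (n k m : ℕ) : Set where
  field
    δ         : Fin n → Fin k → Fin n
    out       : Fin n → Fin m
    init      : Fin n
    reachable : ∀ q → ∃[ w ] (q ≡ act δ init w)

toMoore : ∀ {n k m} → MooreMachine n k m → Moore (Fin k) (Fin m)
toMoore {n} M = record
  { State    = Fin n
  ; _≈_      = _≡_
  ; ≈-equiv  = isEquivalence
  ; δ        = δ
  ; out      = out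
  ; init     = init
  ; δ-cong   = λ j e → cong (λ s → δ s j) e
  ; out-cong = cong out
  }
  where open MooreMachine M

natural : {A B : Set} → Moore A B → Moore A B
natural M = LeftDual (RightDual M)

{-# OPTIONS --safe #-}
-- Every state of the left dual ⋆M is reached from λ by the right action: the state
-- λ·w equals λ ·ʳ w.  Hence τ_{λ·w} is the state λ_⋆·w of the bidual, τ is onto,
-- and it commutes with transitions, outputs and initial states by unfolding.  Only
-- injectivity needs an assumption: to separate two states f, g of ⋆M at a state x
-- of M, the evaluation f ↦ f(x) must be a state of the right dual of ⋆M, which holds
-- when x = v·i for some word v.  Both M and M_⋆ are reachable in this sense.
module Submission where

open import Defs
open import Data.Product using (_×_; _,_; proj₁; ∃-syntax)
open import Data.List using ([]; _∷_; _∷ʳ_; reverse)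
open import Data.List.Properties using (unfold-reverse)
open import Relation.Binary.PropositionalEquality
  using (_≡_; refl; sym; trans; cong; module ≡-Reasoning)
open import Relation.Binary.Structures using (IsEquivalence)

module _ {A B : Set} (K : Moore A B) where
  open Moore K

  ·ˡ-cong : ∀ w {a b} → a ≈ b → _·ˡ_ K w a ≈ _·ˡ_ K w b
  ·ˡ-cong []      e = e
  ·ˡ-cong (j ∷ w) e = δ-cong j (·ˡ-cong w e)

  ·ʳ-cong : ∀ w {a b} → a ≈ b → _·ʳ_ K a w ≈ _·ʳ_ K b w
  ·ʳ-cong []      e = e
  ·ʳ-cong (j ∷ w) e = ·ʳ-cong w (δ-cong j e)

  LeftReachable : Set
  LeftReachable = ∀ x → ∃[ v ] (_·ˡ_ K v init ≈ x)

  leftDual-state-cong : ∀ (f : Moore.State (LeftDual K)) {x y} →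
                        x ≈ y → proj₁ f x ≡ proj₁ f y
  leftDual-state-cong (f , w , p) {x} {y} e =
    trans (p x) (trans (out-cong (·ˡ-cong w e)) (sym (p y)))

  rightDual-state-cong : ∀ (g : Moore.State (RightDual K)) {x y} →
                         x ≈ y → proj₁ g x ≡ proj₁ g y
  rightDual-state-cong (g , w , p) {x} {y} e =
    trans (p x) (trans (out-cong (·ʳ-cong w e)) (sym (p y)))

  leftDual-·ʳ : ∀ (f : Moore.State (LeftDual K)) w x →
                proj₁ (_·ʳ_ (LeftDual K) f w) x ≡ proj₁ f (_·ˡ_ K w x)
  leftDual-·ʳ f []      x = refl
  leftDual-·ʳ f (j ∷ w) x = leftDual-·ʳ (Moore.δ (LeftDual K) f j) w x

  rightDual-·ˡ : ∀ w (g : Moore.State (RightDual K)) x →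
                 proj₁ (_·ˡ_ (RightDual K) w g) x ≡ proj₁ g (_·ʳ_ K x w)
  rightDual-·ˡ []      g x = refl
  rightDual-·ˡ (j ∷ w) g x = rightDual-·ˡ w g (δ x j)

  leftDual-rightReachable : ∀ (f : Moore.State (LeftDual K)) →
                     ∃[ w ] (Moore._≈_ (LeftDual K) (_·ʳ_ (LeftDual K) (Moore.init (LeftDual K)) w) f)
  leftDual-rightReachable (f , w , p) = w , λ x → trans (leftDual-·ʳ _ w x) (sym (p x))

rightDual-leftReachable : {A B : Set} (K : Moore A B) → LeftReachable (RightDual K)
rightDual-leftReachable K (f , w , p) =
  w , λ x → trans (rightDual-·ˡ K w (Moore.init (RightDual K)) x) (sym (p x))

module _ {n k m} (M : MooreMachine n k m) where
  open MooreMachine M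

  act≡reverse-·ˡ : ∀ a w → act δ a w ≡ _·ˡ_ (toMoore M) (reverse w) a
  act≡reverse-·ˡ a []      = refl
  act≡reverse-·ˡ a (j ∷ w) = begin
    act δ (δ a j) w                      ≡⟨ act≡reverse-·ˡ (δ a j) w ⟩
    _·ˡ_ (toMoore M) (reverse w) (δ a j) ≡˘⟨ ·ˡ-snoc (toMoore M) (reverse w) j a ⟩
    _·ˡ_ (toMoore M) (reverse w ∷ʳ j) a  ≡˘⟨ cong (λ v → _·ˡ_ (toMoore M) v a) (unfold-reverse j w) ⟩
    _·ˡ_ (toMoore M) (reverse (j ∷ w)) a ∎
    where open ≡-Reasoning

  toMoore-leftReachable : LeftReachable (toMoore M)
  toMoore-leftReachable x =
    let w , x≡iw = reachable x in reverse w , sym (trans x≡iw (act≡reverse-·ˡ init w))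

module _ {A B : Set} (K : Moore A B) where
  open Moore K
  private
    L = LeftDual K
    R = RightDual L
    module L = Moore L

  evaluationState : LeftReachable K → State → Moore.State R
  evaluationState reach x =
    let v , vi≈x = reach x
    in  (λ f → proj₁ f x) , v , λ f →
          trans (leftDual-state-cong K f (IsEquivalence.sym ≈-equiv vi≈x))
                (sym (leftDual-·ʳ K f v init))

  ev-inBidual : ∀ f → InLeftDualSet R (ev L f)
  ev-inBidual f =
    let w , iw≈f = leftDual-rightReachable K f
    in  w , λ g → trans (rightDual-state-cong L g (λ x → sym (iw≈f x)))
                        (sym (rightDual-·ˡ L w g L.init))

  leftDual-equalToBidual : LeftReachable K → EqualToBidual L
  leftDual-equalToBidual reach =
      ev-inBidual
    , (λ f g f≈g h → rightDual-state-cong L h f≈g)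
    , (λ f g τf≐τg x → τf≐τg (evaluationState reach x))
    , (λ { (C , u , C≐) → _·ʳ_ L L.init u , λ g →
             trans (sym (rightDual-·ˡ L u g L.init)) (sym (C≐ g)) })
    , (λ f j g → refl)
    , (λ f → refl)
    , (λ g → refl)

mainTheorem3 : ∀ {n k m} (M : MooreMachine n k m) →
    EqualToBidual (LeftDual (toMoore M)) × EqualToBidual (natural (toMoore M))
mainTheorem3 M =
    leftDual-equalToBidual (toMoore M) (toMoore-leftReachable M)
  , leftDual-equalToBidual (RightDual (toMoore M)) (rightDual-leftReachable (toMoore M))
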